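{- If some variety of residuated ortholattices containing $\mathsf{OML}$ has a decidable equational theory, then $\mathsf{OML}$ has a decidable equational theory.
   Context: A residuated ortholattice is an algebra $(A,\wedge,\vee,\neg,\backslash,0,1)$ where $(A,\wedge,\vee,0,1)$ is a bounded lattice, $\neg$ is an order-reversing involution, and $x\cdot y\le z\iff y\le x\backslash z$ for all $x,y,z$, where $x\cdot y:=x\wedge(\neg x\vee y)$. Orthomodular lattices (ortholattices satisfying $x\le y\implies y\approx x\vee(y\wedge\neg x)$) are regarded as residuated ortholattices with $x\backslash y:=\neg x\vee(x\wedge y)$, and $\mathsf{OML}$ is the resulting variety. -}

module Defs where

open import Level using (0ℓ)
open import Data.Nat using (ℕ)
open import Data.Product using (_×_)
open import Relation.Binary.Bundles using (Setoid)
open import Relation.Nullary using (Dec)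

data Term : Set where
  var  : ℕ → Term
  _∧ₜ_ : Term → Term → Term
  _∨ₜ_ : Term → Term → Term
  ¬ₜ_  : Term → Term
  _⇀ₜ_ : Term → Term → Term
  0ₜ   : Term
  1ₜ   : Term

record Equation : Set where
  constructor _≐_
  field
    lhs : Term
    rhs : Term

record RAlg : Set₁ where
  field
    setoid : Setoid 0ℓ 0ℓ
  open Setoid setoid public renaming (Carrier to A)
  field
    _∧_ _∨_ _⇀_ : A → A → A
    ¬_ : A → A
    ⊥ ⊤ : A
    ∧-cong : ∀ {x x' y y'} → x ≈ x' → y ≈ y' → (x ∧ y) ≈ (x' ∧ y')
    ∨-cong : ∀ {x x' y y'} → x ≈ x' → y ≈ y' → (x ∨ y) ≈ (x' ∨ y')
    ⇀-cong : ∀ {x x' y y'} → x ≈ x' → y ≈ y' → (x ⇀ y) ≈ (x' ⇀ y')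
    ¬-cong : ∀ {x x'} → x ≈ x' → (¬ x) ≈ (¬ x')

  infixr 7 _∧_
  infixr 6 _∨_

  _≤_ : A → A → Set
  x ≤ y = (x ∧ y) ≈ x

  _·_ : A → A → A
  x · y = x ∧ (¬ x ∨ y)

  ⟦_⟧ : Term → (ℕ → A) → A
  ⟦ var n ⟧ ρ = ρ n
  ⟦ s ∧ₜ t ⟧ ρ = ⟦ s ⟧ ρ ∧ ⟦ t ⟧ ρ
  ⟦ s ∨ₜ t ⟧ ρ = ⟦ s ⟧ ρ ∨ ⟦ t ⟧ ρ
  ⟦ ¬ₜ s ⟧ ρ = ¬ ⟦ s ⟧ ρ
  ⟦ s ⇀ₜ t ⟧ ρ = ⟦ s ⟧ ρ ⇀ ⟦ t ⟧ ρ
  ⟦ 0ₜ ⟧ ρ = ⊥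
  ⟦ 1ₜ ⟧ ρ = ⊤

_⊨_ : RAlg → Equation → Set
𝔸 ⊨ (s ≐ t) = ∀ (ρ : ℕ → A) → ⟦ s ⟧ ρ ≈ ⟦ t ⟧ ρ
  where open RAlg 𝔸

record IsBoundedLattice (𝔸 : RAlg) : Set where
  open RAlg 𝔸
  field
    ∧-comm  : ∀ x y → (x ∧ y) ≈ (y ∧ x)
    ∨-comm  : ∀ x y → (x ∨ y) ≈ (y ∨ x)
    ∧-assoc : ∀ x y z → ((x ∧ y) ∧ z) ≈ (x ∧ (y ∧ z))
    ∨-assoc : ∀ x y z → ((x ∨ y) ∨ z) ≈ (x ∨ (y ∨ z))
    ∧-absorbs-∨ : ∀ x y → (x ∧ (x ∨ y)) ≈ x
    ∨-absorbs-∧ : ∀ x y → (x ∨ (x ∧ y)) ≈ x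
    ⊥-min : ∀ x → ⊥ ≤ x
    ⊤-max : ∀ x → x ≤ ⊤

record IsRO (𝔸 : RAlg) : Set where
  open RAlg 𝔸
  field
    boundedLattice : IsBoundedLattice 𝔸
    ¬-involutive : ∀ x → (¬ (¬ x)) ≈ x
    ¬-antitone : ∀ {x y} → x ≤ y → (¬ y) ≤ (¬ x)
    residuated⇒ : ∀ x y z → (x · y) ≤ z → y ≤ (x ⇀ z)
    residuated⇐ : ∀ x y z → y ≤ (x ⇀ z) → (x · y) ≤ z

-- Orthomodular lattice regarded as a residuated ortholattice:
-- an ortholattice satisfying the orthomodular law, with x \ y := ¬x ∨ (x ∧ y).
record IsOML (𝔸 : RAlg) : Set where
  open RAlg 𝔸
  field
    boundedLattice : IsBoundedLattice 𝔸
    ¬-involutive : ∀ x → (¬ (¬ x)) ≈ x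
    ¬-antitone : ∀ {x y} → x ≤ y → (¬ y) ≤ (¬ x)
    ∧-complement : ∀ x → (x ∧ ¬ x) ≈ ⊥
    ∨-complement : ∀ x → (x ∨ ¬ x) ≈ ⊤
    orthomodular : ∀ {x y} → x ≤ y → y ≈ (x ∨ (y ∧ ¬ x))
    ⇀-def : ∀ x y → (x ⇀ y) ≈ (¬ x ∨ (x ∧ y))

InVariety : (Equation → Set) → RAlg → Set
InVariety Σ 𝔸 = IsRO 𝔸 × (∀ e → Σ e → 𝔸 ⊨ e)

EqTheory : (RAlg → Set) → Equation → Set₁
EqTheory K e = ∀ (𝔸 : RAlg) → K 𝔸 → 𝔸 ⊨ e

HasDecidableEqTheory : (RAlg → Set) → Set₁
HasDecidableEqTheory K = ∀ (e : Equation) → Dec (EqTheory K e)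

ContainsOML : (Equation → Set) → Set₁
ContainsOML Σ = ∀ (𝔸 : RAlg) → IsOML 𝔸 → InVariety Σ 𝔸

-- In a residuated ortholattice A the map γ x = (x \ 0) \ 0 is a closure operator, and its
-- closed elements form an orthomodular lattice γ[A]: meets are taken in A, joins are γ(x ∨ y),
-- the complement is x \ 0 and x \ y is γ((x \ 0) ∨ (x ∧ y)). The term translation below
-- computes in A the value of a term in γ[A] at closed arguments, and it is the identity on
-- orthomodular lattices, where x \ 0 = ¬x. So for a variety V containing OML, an equation
-- holds in OML iff its translation holds in V, and deciding V decides OML.
module Submission where

open import Defs
open import Level using (0ℓ)
open import Data.Nat using (ℕ)
open import Data.Product using (Σ; _,_; proj₁; proj₂)
open import Function using (_∘_; _⇔_; mk⇔)
import Function.Properties.Equivalence as Equivalence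
import Relation.Nullary.Decidable as Dec
open import Relation.Binary.Structures using (IsPartialOrder)
open import Relation.Binary.Lattice using (BoundedLattice)
import Relation.Binary.Lattice.Properties.JoinSemilattice as JoinSemilatticeProperties
import Relation.Binary.Lattice.Properties.MeetSemilattice as MeetSemilatticeProperties
import Relation.Binary.Lattice.Properties.BoundedLattice as BoundedLatticeProperties
import Relation.Binary.Lattice.Properties.BoundedJoinSemilattice as BoundedJoinSemilatticeProperties

module LatticeOrder (𝔸 : RAlg) (isBL : IsBoundedLattice 𝔸) where
  open RAlg 𝔸
  open IsBoundedLattice isBL
  open import Relation.Binary.Reasoning.Setoid setoid

  ∧-idem : ∀ x → x ∧ x ≈ x
  ∧-idem x = trans (∧-cong refl (sym (∨-absorbs-∧ x x))) (∧-absorbs-∨ x (x ∧ x))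

  ≤-isPartialOrder : IsPartialOrder _≈_ _≤_
  ≤-isPartialOrder = record
    { isPreorder = record
      { isEquivalence = isEquivalence
      ; reflexive = λ {x} x≈y → trans (∧-cong refl (sym x≈y)) (∧-idem x)
      ; trans = λ {x} {y} {z} x≤y y≤z →
          trans (∧-cong (sym x≤y) refl)
            (trans (∧-assoc x y z) (trans (∧-cong refl y≤z) x≤y))
      }
    ; antisym = λ {x} {y} x≤y y≤x → trans (sym x≤y) (trans (∧-comm x y) y≤x)
    }

  private
    ≤⇒∨≈ : ∀ {x y} → x ≤ y → x ∨ y ≈ y
    ≤⇒∨≈ {x} {y} x≤y = begin
      x ∨ y        ≈⟨ ∨-cong (sym x≤y) refl ⟩
      (x ∧ y) ∨ y  ≈⟨ ∨-comm (x ∧ y) y ⟩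
      y ∨ (x ∧ y)  ≈⟨ ∨-cong refl (∧-comm x y) ⟩
      y ∨ (y ∧ x)  ≈⟨ ∨-absorbs-∧ y x ⟩
      y            ∎

    ∨≈⇒≤ : ∀ {x y} → x ∨ y ≈ y → x ≤ y
    ∨≈⇒≤ {x} {y} x∨y≈y = trans (∧-cong refl (sym x∨y≈y)) (∧-absorbs-∨ x y)

  x≤x∨y : ∀ x y → x ≤ (x ∨ y)
  x≤x∨y = ∧-absorbs-∨

  y≤x∨y : ∀ x y → y ≤ (x ∨ y)
  y≤x∨y x y = trans (∧-cong refl (∨-comm x y)) (∧-absorbs-∨ y x)

  ∨-least : ∀ {x y z} → x ≤ z → y ≤ z → (x ∨ y) ≤ z
  ∨-least {x} {y} {z} x≤z y≤z = ∨≈⇒≤ (begin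
    (x ∨ y) ∨ z  ≈⟨ ∨-assoc x y z ⟩
    x ∨ (y ∨ z)  ≈⟨ ∨-cong refl (≤⇒∨≈ y≤z) ⟩
    x ∨ z        ≈⟨ ≤⇒∨≈ x≤z ⟩
    z            ∎)

  x∧y≤x : ∀ x y → (x ∧ y) ≤ x
  x∧y≤x x y = begin
    (x ∧ y) ∧ x  ≈⟨ ∧-assoc x y x ⟩
    x ∧ (y ∧ x)  ≈⟨ ∧-cong refl (∧-comm y x) ⟩
    x ∧ (x ∧ y)  ≈⟨ sym (∧-assoc x x y) ⟩
    (x ∧ x) ∧ y  ≈⟨ ∧-cong (∧-idem x) refl ⟩
    x ∧ y        ∎

  x∧y≤y : ∀ x y → (x ∧ y) ≤ y
  x∧y≤y x y = trans (∧-assoc x y y) (∧-cong refl (∧-idem y))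

  ∧-greatest : ∀ {x y z} → z ≤ x → z ≤ y → z ≤ (x ∧ y)
  ∧-greatest {x} {y} {z} z≤x z≤y = begin
    z ∧ (x ∧ y)  ≈⟨ sym (∧-assoc z x y) ⟩
    (z ∧ x) ∧ y  ≈⟨ ∧-cong z≤x refl ⟩
    z ∧ y        ≈⟨ z≤y ⟩
    z            ∎

  boundedLattice : BoundedLattice 0ℓ 0ℓ 0ℓ
  boundedLattice = record
    { _≈_ = _≈_
    ; _≤_ = _≤_
    ; _∨_ = _∨_
    ; _∧_ = _∧_
    ; ⊤ = ⊤
    ; ⊥ = ⊥
    ; isBoundedLattice = record
      { isLattice = record
        { isPartialOrder = ≤-isPartialOrder
        ; supremum = λ x y → x≤x∨y x y , y≤x∨y x y , λ _ → ∨-least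
        ; infimum = λ x y → x∧y≤x x y , x∧y≤y x y , λ _ → ∧-greatest
        }
      ; maximum = ⊤-max
      ; minimum = ⊥-min
      }
    }

  open BoundedLattice boundedLattice public
    using (poset; ≤-respˡ-≈; ≤-respʳ-≈)
    renaming (refl to ≤-refl; trans to ≤-trans; antisym to ≤-antisym; reflexive to ≤-reflexive)
  open JoinSemilatticeProperties (BoundedLattice.joinSemilattice boundedLattice) public
    using (∨-monotonic; ∨-idempotent; x≤y⇒x∨y≈y)
  open MeetSemilatticeProperties (BoundedLattice.meetSemilattice boundedLattice) public
    using (∧-monotonic)
  open BoundedJoinSemilatticeProperties
    (BoundedLattice.boundedJoinSemilattice boundedLattice) public using (identityʳ)
  open BoundedLatticeProperties boundedLattice public
    using (∧-zeroʳ; ∨-zeroʳ)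

module Involution (𝔸 : RAlg) (isBL : IsBoundedLattice 𝔸)
  (¬-involutive : ∀ x → RAlg._≈_ 𝔸 (RAlg.¬_ 𝔸 (RAlg.¬_ 𝔸 x)) x)
  (¬-antitone : ∀ {x y} → RAlg._≤_ 𝔸 x y → RAlg._≤_ 𝔸 (RAlg.¬_ 𝔸 y) (RAlg.¬_ 𝔸 x)) where
  open RAlg 𝔸
  open IsBoundedLattice isBL using (⊥-min; ⊤-max)
  open LatticeOrder 𝔸 isBL
  open import Relation.Binary.Reasoning.Setoid setoid

  ≤¬-sym : ∀ {x y} → x ≤ (¬ y) → y ≤ (¬ x)
  ≤¬-sym x≤¬y = ≤-respˡ-≈ (¬-involutive _) (¬-antitone x≤¬y)

  ¬-distrib-∨ : ∀ x y → ¬ (x ∨ y) ≈ (¬ x) ∧ (¬ y)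
  ¬-distrib-∨ x y = ≤-antisym
    (∧-greatest (¬-antitone (x≤x∨y x y)) (¬-antitone (y≤x∨y x y)))
    (≤¬-sym (∨-least (≤¬-sym (x∧y≤x (¬ x) (¬ y))) (≤¬-sym (x∧y≤y (¬ x) (¬ y)))))

  ¬-distrib-∧ : ∀ x y → ¬ (x ∧ y) ≈ (¬ x) ∨ (¬ y)
  ¬-distrib-∧ x y = begin
    ¬ (x ∧ y)                  ≈⟨ ¬-cong (∧-cong (sym (¬-involutive x)) (sym (¬-involutive y))) ⟩
    ¬ ((¬ (¬ x)) ∧ (¬ (¬ y)))  ≈⟨ ¬-cong (sym (¬-distrib-∨ (¬ x) (¬ y))) ⟩
    ¬ (¬ ((¬ x) ∨ (¬ y)))      ≈⟨ ¬-involutive _ ⟩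
    (¬ x) ∨ (¬ y)              ∎

  ¬⊥≈⊤ : ¬ ⊥ ≈ ⊤
  ¬⊥≈⊤ = ≤-antisym (⊤-max (¬ ⊥)) (≤¬-sym (⊥-min (¬ ⊤)))

  ¬⊤≈⊥ : ¬ ⊤ ≈ ⊥
  ¬⊤≈⊥ = trans (¬-cong (sym ¬⊥≈⊤)) (¬-involutive ⊥)

module ResiduatedOrtholattice (𝔸 : RAlg) (isRO : IsRO 𝔸) where
  open RAlg 𝔸
  open IsRO isRO renaming (boundedLattice to isBL)
  open IsBoundedLattice isBL using (∧-comm; ∨-comm; ∧-assoc; ∨-assoc; ⊥-min; ⊤-max)
  open LatticeOrder 𝔸 isBL public
  open Involution 𝔸 isBL ¬-involutive ¬-antitone public
  open import Relation.Binary.Reasoning.PartialOrder poset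

  ~_ : A → A
  ~ x = x ⇀ ⊥

  γ : A → A
  γ x = ~ (~ x)

  ~-cong : ∀ {x y} → x ≈ y → ~ x ≈ ~ y
  ~-cong x≈y = ⇀-cong x≈y refl

  γ-cong : ∀ {x y} → x ≈ y → γ x ≈ γ y
  γ-cong x≈y = ~-cong (~-cong x≈y)

  ·≤⊥⇒≤~ : ∀ {x y} → (x · y) ≤ ⊥ → y ≤ (~ x)
  ·≤⊥⇒≤~ {x} {y} = residuated⇒ x y ⊥

  ≤~⇒·≤⊥ : ∀ {x y} → y ≤ (~ x) → (x · y) ≤ ⊥
  ≤~⇒·≤⊥ {x} {y} = residuated⇐ x y ⊥

  x∧¬x≤⊥ : ∀ x → (x ∧ ¬ x) ≤ ⊥
  x∧¬x≤⊥ x = ≤-respˡ-≈ (∧-cong refl (identityʳ (¬ x))) (≤~⇒·≤⊥ (⊥-min (~ x)))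

  x·⊤≈x : ∀ x → x · ⊤ ≈ x
  x·⊤≈x x = trans (∧-cong refl (∨-zeroʳ (¬ x))) (⊤-max x)

  ⊤·x≈x : ∀ x → ⊤ · x ≈ x
  ⊤·x≈x x = trans (∧-comm ⊤ _) (trans (⊤-max _)
    (trans (∨-cong ¬⊤≈⊥ refl) (trans (∨-comm ⊥ x) (identityʳ x))))

  -- With z = s · ¬u, both ¬u and ¬a lie below s \ z, hence so does ¬u ∨ ¬a = ⊤;
  -- thus s = s · ⊤ ≤ z ≤ ¬(s ∧ u) = ¬u, and u ≤ s ≤ ¬u forces u = ⊥.
  disjoint-from-dense⇒≤⊥ : ∀ {a s u} → a ≤ s → (s ∧ ¬ a) ≤ ⊥ → u ≤ s → (u ∧ a) ≤ ⊥ → u ≤ ⊥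
  disjoint-from-dense⇒≤⊥ {a} {s} {u} a≤s s∧¬a≤⊥ u≤s u∧a≤⊥ = begin
    u        ≤⟨ ∧-greatest ≤-refl (≤-trans u≤s s≤¬u) ⟩
    u ∧ ¬ u  ≤⟨ x∧¬x≤⊥ u ⟩
    ⊥        ∎
    where
    z : A
    z = s · (¬ u)
    ¬a≤s⇀z : (¬ a) ≤ (s ⇀ z)
    ¬a≤s⇀z = residuated⇒ s (¬ a) z (begin
      s · (¬ a)  ≈⟨ ∧-cong refl (x≤y⇒x∨y≈y (¬-antitone a≤s)) ⟩
      s ∧ (¬ a)  ≤⟨ s∧¬a≤⊥ ⟩
      ⊥          ≤⟨ ⊥-min z ⟩
      z          ∎)
    ⊤≤s⇀z : ⊤ ≤ (s ⇀ z)
    ⊤≤s⇀z = begin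
      ⊤                ≈⟨ sym ¬⊥≈⊤ ⟩
      ¬ ⊥              ≈⟨ ¬-cong (sym (≤-antisym u∧a≤⊥ (⊥-min _))) ⟩
      ¬ (u ∧ a)        ≈⟨ ¬-distrib-∧ u a ⟩
      (¬ u) ∨ (¬ a)    ≤⟨ ∨-least (residuated⇒ s (¬ u) z ≤-refl) ¬a≤s⇀z ⟩
      s ⇀ z            ∎
    s≤¬u : s ≤ (¬ u)
    s≤¬u = begin
      s                  ≈⟨ sym (x·⊤≈x s) ⟩
      s · ⊤              ≤⟨ residuated⇐ s ⊤ z ⊤≤s⇀z ⟩
      s ∧ ((¬ s) ∨ ¬ u)  ≤⟨ x∧y≤y s _ ⟩
      (¬ s) ∨ (¬ u)      ≈⟨ sym (¬-distrib-∧ s u) ⟩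
      ¬ (s ∧ u)          ≈⟨ ¬-cong (trans (∧-comm s u) u≤s) ⟩
      ¬ u                ∎

  ·≤⊥-sym : ∀ {x y} → (x · y) ≤ ⊥ → (y · x) ≤ ⊥
  ·≤⊥-sym {x} {y} x·y≤⊥ =
    disjoint-from-dense⇒≤⊥ (x≤x∨y (¬ x) y) s∧¬¬x≤⊥ y·x≤s y·x∧¬x≤⊥
    where
    s : A
    s = (¬ x) ∨ y
    s∧¬¬x≤⊥ : (s ∧ ¬ (¬ x)) ≤ ⊥
    s∧¬¬x≤⊥ = ≤-respˡ-≈ (trans (∧-comm x s) (∧-cong refl (sym (¬-involutive x)))) x·y≤⊥
    y·x≤s : (y · x) ≤ s
    y·x≤s = ≤-trans (x∧y≤x y _) (y≤x∨y (¬ x) y)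
    y·x∧¬x≤⊥ : ((y · x) ∧ ¬ x) ≤ ⊥
    y·x∧¬x≤⊥ = begin
      (y · x) ∧ ¬ x                  ≤⟨ ∧-greatest (≤-trans (x∧y≤x _ _) (x∧y≤y y _))
                                                     (∧-monotonic (x∧y≤x y _) ≤-refl) ⟩
      ((¬ y) ∨ x) ∧ (y ∧ ¬ x)        ≈⟨ ∧-cong refl (sym (trans (¬-distrib-∨ (¬ y) x)
                                                               (∧-cong (¬-involutive y) refl))) ⟩
      ((¬ y) ∨ x) ∧ ¬ ((¬ y) ∨ x)    ≤⟨ x∧¬x≤⊥ _ ⟩
      ⊥                              ∎

  ≤~-sym : ∀ {x y} → y ≤ (~ x) → x ≤ (~ y)
  ≤~-sym y≤~x = ·≤⊥⇒≤~ (·≤⊥-sym (≤~⇒·≤⊥ y≤~x))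

  x≤γx : ∀ x → x ≤ γ x
  x≤γx x = ≤~-sym ≤-refl

  ~-antitone : ∀ {x y} → x ≤ y → (~ y) ≤ (~ x)
  ~-antitone {x} {y} x≤y = ≤~-sym (≤-trans x≤y (x≤γx y))

  γ-monotone : ∀ {x y} → x ≤ y → γ x ≤ γ y
  γ-monotone x≤y = ~-antitone (~-antitone x≤y)

  ~γx≈~x : ∀ x → ~ (γ x) ≈ ~ x
  ~γx≈~x x = ≤-antisym (~-antitone (x≤γx x)) (x≤γx (~ x))

  γ-idempotent : ∀ x → γ (γ x) ≈ γ x
  γ-idempotent x = ~-cong (~γx≈~x x)

  ~⊥≈⊤ : ~ ⊥ ≈ ⊤
  ~⊥≈⊤ = ≤-antisym (⊤-max _) (·≤⊥⇒≤~ (x∧y≤x ⊥ _))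

  ~⊤≈⊥ : ~ ⊤ ≈ ⊥
  ~⊤≈⊥ = ≤-antisym (≤-respˡ-≈ (⊤·x≈x _) (≤~⇒·≤⊥ ≤-refl)) (⊥-min _)

  γ⊥≈⊥ : γ ⊥ ≈ ⊥
  γ⊥≈⊥ = trans (~-cong ~⊥≈⊤) ~⊤≈⊥

  γ⊤≈⊤ : γ ⊤ ≈ ⊤
  γ⊤≈⊤ = trans (~-cong ~⊤≈⊥) ~⊥≈⊤

  x∧~x≤⊥ : ∀ x → (x ∧ ~ x) ≤ ⊥
  x∧~x≤⊥ x = ≤-trans (∧-monotonic ≤-refl (y≤x∨y (¬ x) (~ x))) (≤~⇒·≤⊥ ≤-refl)

  ¬x≤~x : ∀ x → (¬ x) ≤ (~ x)
  ¬x≤~x x = ·≤⊥⇒≤~ (≤-respˡ-≈ (∧-cong refl (sym (∨-idempotent _))) (x∧¬x≤⊥ x))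

  ·≤⊥-extends-dense : ∀ {a b w} → a ≤ b → (b ∧ ¬ a) ≤ ⊥ → (a · w) ≤ ⊥ → (b · w) ≤ ⊥
  ·≤⊥-extends-dense {a} {b} {w} a≤b b∧¬a≤⊥ a·w≤⊥ =
    disjoint-from-dense⇒≤⊥ a≤b b∧¬a≤⊥ (x∧y≤x b _) (begin
      (b · w) ∧ a        ≈⟨ ∧-comm _ a ⟩
      a ∧ (b · w)        ≤⟨ ∧-monotonic ≤-refl
                              (≤-trans (x∧y≤y b _) (∨-monotonic (¬-antitone a≤b) ≤-refl)) ⟩
      a · w              ≤⟨ a·w≤⊥ ⟩
      ⊥                  ∎)

  γ-orthomodular : ∀ {x y} → x ≤ y → γ y ≈ y → y ≈ γ (x ∨ (y ∧ ~ x))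
  γ-orthomodular {x} {y} x≤y γy≈y = ≤-antisym y≤γm (≤-respʳ-≈ γy≈y (γ-monotone m≤y))
    where
    c : A
    c = y ∧ ~ x
    m : A
    m = x ∨ c
    m≤y : m ≤ y
    m≤y = ∨-least x≤y (x∧y≤x y _)
    y∧¬m≤⊥ : (y ∧ ¬ m) ≤ ⊥
    y∧¬m≤⊥ = begin
      y ∧ ¬ m    ≤⟨ ∧-greatest
                      (∧-monotonic ≤-refl (≤-trans (¬-antitone (x≤x∨y x c)) (¬x≤~x x)))
                      (≤-trans (x∧y≤y y _) (¬-antitone (y≤x∨y x c))) ⟩
      c ∧ ¬ c    ≤⟨ x∧¬x≤⊥ c ⟩
      ⊥          ∎
    y≤γm : y ≤ γ m
    y≤γm = ·≤⊥⇒≤~ (·≤⊥-sym (·≤⊥-extends-dense m≤y y∧¬m≤⊥ (≤~⇒·≤⊥ ≤-refl)))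

  γ[x∨~x]≈⊤ : ∀ x → γ (x ∨ ~ x) ≈ ⊤
  γ[x∨~x]≈⊤ x = ≤-antisym (⊤-max _) (≤-respˡ-≈ ~⊥≈⊤ (~-antitone w≤⊥))
    where
    w : A
    w = ~ (x ∨ ~ x)
    w≤⊥ : w ≤ ⊥
    w≤⊥ = begin
      w                ≤⟨ ∧-greatest (≤~-sym (≤-trans (x≤x∨y x _) (x≤γx _)))
                                     (≤~-sym (≤-trans (y≤x∨y x _) (x≤γx _))) ⟩
      ~ x ∧ ~ (~ x)    ≤⟨ x∧~x≤⊥ (~ x) ⟩
      ⊥                ∎

  γ[γx∨y]≈γ[x∨y] : ∀ x y → γ (γ x ∨ y) ≈ γ (x ∨ y)
  γ[γx∨y]≈γ[x∨y] x y = ≤-antisym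
    (≤-respʳ-≈ (γ-idempotent _)
      (γ-monotone (∨-least (γ-monotone (x≤x∨y x y)) (≤-trans (y≤x∨y x y) (x≤γx _)))))
    (γ-monotone (∨-monotonic (x≤γx x) ≤-refl))

  γ[x∨γy]≈γ[x∨y] : ∀ x y → γ (x ∨ γ y) ≈ γ (x ∨ y)
  γ[x∨γy]≈γ[x∨y] x y =
    trans (γ-cong (∨-comm x _)) (trans (γ[γx∨y]≈γ[x∨y] y x) (γ-cong (∨-comm y x)))

  IsClosed : A → Set
  IsClosed x = γ x ≈ x

  ∧-preserves-IsClosed : ∀ {x y} → IsClosed x → IsClosed y → IsClosed (x ∧ y)
  ∧-preserves-IsClosed {x} {y} γx≈x γy≈y = ≤-antisym
    (∧-greatest (≤-respʳ-≈ γx≈x (γ-monotone (x∧y≤x x y)))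
                (≤-respʳ-≈ γy≈y (γ-monotone (x∧y≤y x y))))
    (x≤γx _)

  Closed : Set
  Closed = Σ A IsClosed

  closed : A → Closed
  closed x = γ x , γ-idempotent x

  closedAlgebra : RAlg
  closedAlgebra = record
    { setoid = record
      { Carrier = Closed
      ; _≈_ = λ x y → proj₁ x ≈ proj₁ y
      ; isEquivalence = record { refl = refl ; sym = sym ; trans = trans }
      }
    ; _∧_ = λ (x , γx≈x) (y , γy≈y) → x ∧ y , ∧-preserves-IsClosed γx≈x γy≈y
    ; _∨_ = λ (x , _) (y , _) → closed (x ∨ y)
    ; _⇀_ = λ (x , _) (y , _) → closed (~ x ∨ (x ∧ y))
    ; ¬_ = λ (x , _) → ~ x , ~γx≈~x x
    ; ⊥ = ⊥ , γ⊥≈⊥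
    ; ⊤ = ⊤ , γ⊤≈⊤
    ; ∧-cong = ∧-cong
    ; ∨-cong = λ x≈x' y≈y' → γ-cong (∨-cong x≈x' y≈y')
    ; ⇀-cong = λ x≈x' y≈y' → γ-cong (∨-cong (~-cong x≈x') (∧-cong x≈x' y≈y'))
    ; ¬-cong = ~-cong
    }

  closedAlgebra-isBoundedLattice : IsBoundedLattice closedAlgebra
  closedAlgebra-isBoundedLattice = record
    { ∧-comm = λ (x , _) (y , _) → ∧-comm x y
    ; ∨-comm = λ (x , _) (y , _) → γ-cong (∨-comm x y)
    ; ∧-assoc = λ (x , _) (y , _) (z , _) → ∧-assoc x y z
    ; ∨-assoc = λ (x , _) (y , _) (z , _) → trans (γ[γx∨y]≈γ[x∨y] _ z)
        (trans (γ-cong (∨-assoc x y z)) (sym (γ[x∨γy]≈γ[x∨y] x _)))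
    ; ∧-absorbs-∨ = λ (x , _) (y , _) →
        ≤-antisym (x∧y≤x _ _) (∧-greatest ≤-refl (≤-trans (x≤x∨y x y) (x≤γx _)))
    ; ∨-absorbs-∧ = λ (x , γx≈x) (y , _) →
        trans (γ-cong (trans (∨-comm x _) (x≤y⇒x∨y≈y (x∧y≤x x y)))) γx≈x
    ; ⊥-min = λ (x , _) → ⊥-min x
    ; ⊤-max = λ (x , _) → ⊤-max x
    }

  closedAlgebra-isOML : IsOML closedAlgebra
  closedAlgebra-isOML = record
    { boundedLattice = closedAlgebra-isBoundedLattice
    ; ¬-involutive = proj₂
    ; ¬-antitone = ~-antitone
    ; ∧-complement = λ (x , _) → ≤-antisym (x∧~x≤⊥ x) (⊥-min _)
    ; ∨-complement = λ (x , _) → γ[x∨~x]≈⊤ x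
    ; orthomodular = λ {_} {y} x≤y → γ-orthomodular x≤y (proj₂ y)
    ; ⇀-def = λ _ _ → refl
    }

~ₜ_ : Term → Term
~ₜ s = s ⇀ₜ 0ₜ

γₜ : Term → Term
γₜ s = ~ₜ (~ₜ s)

translate : Term → Term
translate (var n) = γₜ (var n)
translate (s ∧ₜ t) = translate s ∧ₜ translate t
translate (s ∨ₜ t) = γₜ (translate s ∨ₜ translate t)
translate (¬ₜ s) = ~ₜ (translate s)
translate (s ⇀ₜ t) = γₜ ((~ₜ (translate s)) ∨ₜ (translate s ∧ₜ translate t))
translate 0ₜ = 0ₜ
translate 1ₜ = 1ₜ

translateEq : Equation → Equation
translateEq (s ≐ t) = translate s ≐ translate t

module _ (𝔸 : RAlg) (isRO : IsRO 𝔸) where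
  open RAlg 𝔸
  open ResiduatedOrtholattice 𝔸 isRO
  private module C = RAlg closedAlgebra
  open import Relation.Binary.Reasoning.Setoid setoid

  ⟦translate⟧≈closed⟦⟧ : ∀ s (ρ : ℕ → A) → ⟦ translate s ⟧ ρ ≈ proj₁ (C.⟦ s ⟧ (closed ∘ ρ))
  ⟦translate⟧≈closed⟦⟧ (var n) ρ = refl
  ⟦translate⟧≈closed⟦⟧ (s ∧ₜ t) ρ =
    ∧-cong (⟦translate⟧≈closed⟦⟧ s ρ) (⟦translate⟧≈closed⟦⟧ t ρ)
  ⟦translate⟧≈closed⟦⟧ (s ∨ₜ t) ρ =
    γ-cong (∨-cong (⟦translate⟧≈closed⟦⟧ s ρ) (⟦translate⟧≈closed⟦⟧ t ρ))
  ⟦translate⟧≈closed⟦⟧ (¬ₜ s) ρ = ~-cong (⟦translate⟧≈closed⟦⟧ s ρ)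
  ⟦translate⟧≈closed⟦⟧ (s ⇀ₜ t) ρ =
    γ-cong (∨-cong (~-cong (⟦translate⟧≈closed⟦⟧ s ρ))
      (∧-cong (⟦translate⟧≈closed⟦⟧ s ρ) (⟦translate⟧≈closed⟦⟧ t ρ)))
  ⟦translate⟧≈closed⟦⟧ 0ₜ ρ = refl
  ⟦translate⟧≈closed⟦⟧ 1ₜ ρ = refl

  OML-valid⇒translateEq-holds : ∀ e → EqTheory IsOML e → 𝔸 ⊨ translateEq e
  OML-valid⇒translateEq-holds (s ≐ t) ⊨e ρ = begin
    ⟦ translate s ⟧ ρ             ≈⟨ ⟦translate⟧≈closed⟦⟧ s ρ ⟩
    proj₁ (C.⟦ s ⟧ (closed ∘ ρ))  ≈⟨ ⊨e closedAlgebra closedAlgebra-isOML (closed ∘ ρ) ⟩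
    proj₁ (C.⟦ t ⟧ (closed ∘ ρ))  ≈⟨ ⟦translate⟧≈closed⟦⟧ t ρ ⟨
    ⟦ translate t ⟧ ρ             ∎

module _ (𝔸 : RAlg) (isOML : IsOML 𝔸) where
  open RAlg 𝔸
  open IsOML isOML
  open LatticeOrder 𝔸 boundedLattice using (identityʳ; ∧-zeroʳ)

  x⇀⊥≈¬x : ∀ x → (x ⇀ ⊥) ≈ ¬ x
  x⇀⊥≈¬x x = trans (⇀-def x ⊥) (trans (∨-cong refl (∧-zeroʳ x)) (identityʳ (¬ x)))

  [x⇀⊥]⇀⊥≈x : ∀ x → ((x ⇀ ⊥) ⇀ ⊥) ≈ x
  [x⇀⊥]⇀⊥≈x x = trans (x⇀⊥≈¬x _) (trans (¬-cong (x⇀⊥≈¬x x)) (¬-involutive x))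

  ⟦translate⟧≈⟦⟧ : ∀ s ρ → ⟦ translate s ⟧ ρ ≈ ⟦ s ⟧ ρ
  ⟦translate⟧≈⟦⟧ (var n) ρ = [x⇀⊥]⇀⊥≈x (ρ n)
  ⟦translate⟧≈⟦⟧ (s ∧ₜ t) ρ = ∧-cong (⟦translate⟧≈⟦⟧ s ρ) (⟦translate⟧≈⟦⟧ t ρ)
  ⟦translate⟧≈⟦⟧ (s ∨ₜ t) ρ =
    trans ([x⇀⊥]⇀⊥≈x _) (∨-cong (⟦translate⟧≈⟦⟧ s ρ) (⟦translate⟧≈⟦⟧ t ρ))
  ⟦translate⟧≈⟦⟧ (¬ₜ s) ρ = trans (x⇀⊥≈¬x _) (¬-cong (⟦translate⟧≈⟦⟧ s ρ))
  ⟦translate⟧≈⟦⟧ (s ⇀ₜ t) ρ =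
    trans ([x⇀⊥]⇀⊥≈x _)
      (trans (∨-cong (trans (x⇀⊥≈¬x _) (¬-cong s≈)) (∧-cong s≈ t≈)) (sym (⇀-def _ _)))
    where
    s≈ : ⟦ translate s ⟧ ρ ≈ ⟦ s ⟧ ρ
    s≈ = ⟦translate⟧≈⟦⟧ s ρ
    t≈ : ⟦ translate t ⟧ ρ ≈ ⟦ t ⟧ ρ
    t≈ = ⟦translate⟧≈⟦⟧ t ρ
  ⟦translate⟧≈⟦⟧ 0ₜ ρ = refl
  ⟦translate⟧≈⟦⟧ 1ₜ ρ = refl

  translateEq-holds⇒holds : ∀ e → 𝔸 ⊨ translateEq e → 𝔸 ⊨ e
  translateEq-holds⇒holds (s ≐ t) ⊨e′ ρ =
    trans (sym (⟦translate⟧≈⟦⟧ s ρ)) (trans (⊨e′ ρ) (⟦translate⟧≈⟦⟧ t ρ))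

OML-valid⇔translateEq-valid : (Σ : Equation → Set) → ContainsOML Σ →
  ∀ e → EqTheory IsOML e ⇔ EqTheory (InVariety Σ) (translateEq e)
OML-valid⇔translateEq-valid Σ OML⊆V e = mk⇔
  (λ ⊨e 𝔸 (isRO , _) → OML-valid⇒translateEq-holds 𝔸 isRO e ⊨e)
  (λ ⊨e′ 𝔸 isOML → translateEq-holds⇒holds 𝔸 isOML e (⊨e′ 𝔸 (OML⊆V 𝔸 isOML)))

corollary4p13 : (Σ : Equation → Set) → ContainsOML Σ →
    HasDecidableEqTheory (InVariety Σ) → HasDecidableEqTheory IsOML
corollary4p13 Σ OML⊆V decide e =
  Dec.map (Equivalence.sym (OML-valid⇔translateEq-valid Σ OML⊆V e)) (decide (translateEq e))
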